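{- Let $\mathbb F$ be a field, $n\ge k\ge1$, $A\in\mathcal M_{n\,n}(\mathbb F)$, $B\in\mathcal M_{k\,k}(\mathbb F)$, and let $T\colon\mathcal M_{n\,k}(\mathbb F)\to\mathcal M_{n\,k}(\mathbb F)$ be defined by $T(X)=AXB$. Then $\det_{n\,k}(T(X))=\det_{n\,k}(X)$ for all $X\in\mathcal M_{n\,k}(\mathbb F)$ if and only if \[ \det_{n\,k}\bigl(A(|d]\bigr)\cdot\det_k(B)=\operatorname{sgn}(d) \] for every $k$-element subset $d\subseteq\{1,\ldots,n\}$.
   Context: $\mathcal M_{n\,k}(\mathbb F)$ denotes the $n\times k$ matrices over $\mathbb F$. For a $k$-element subset $d=\{d_1<\cdots<d_k\}\subseteq\{1,\ldots,n\}$, $\operatorname{sgn}(d)=(-1)^{\sum_{\alpha=1}^k(d_\alpha-\alpha)}$, $A(|d]$ denotes the $n\times k$ submatrix of $A$ formed by the columns $d_1,\ldots,d_k$, and $X[d|)$ the $k\times k$ submatrix of $X$ formed by the rows $d_1,\ldots,d_k$. The Cullis determinant of $X\in\mathcal M_{n\,k}(\mathbb F)$ is $\det_{n\,k}(X)=\sum_{d}\operatorname{sgn}(d)\det(X[d|))$, sum over all $k$-element subsets $d$ of $\{1,\ldots,n\}$; $\det_k$ is the ordinary determinant. -}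

module Defs where

open import Level using (Level; _⊔_)
open import Algebra.Bundles using (CommutativeRing)
open import Data.Nat as ℕ using (ℕ; zero; suc)
open import Data.Fin as Fin using (Fin; zero; suc; toℕ; punchIn)
open import Data.List using (List; []; _∷_; _++_; map)
open import Data.Product using (Σ; _,_)
open import Relation.Nullary using (¬_)

record Field (c ℓ : Level) : Set (Level.suc (c ⊔ ℓ)) where
  field
    commutativeRing : CommutativeRing c ℓ
  open CommutativeRing commutativeRing public
  field
    1≉0     : ¬ (1# ≈ 0#)
    inverse : ∀ x → ¬ (x ≈ 0#) → Σ Carrier (λ y → x * y ≈ 1#)

-- Strictly increasing maps Fin k → Fin n, i.e. k-element subsets
-- d = {d₁ < ⋯ < d_k} of {1,…,n} (indices are 0-based here).
StrictlyIncreasing : ∀ {n k} → (Fin k → Fin n) → Set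
StrictlyIncreasing d = ∀ i j → i Fin.< j → d i Fin.< d j

-- Enumeration of all k-element subsets of {0,…,n-1}, each exactly once,
-- as increasing maps: either 0 ∈ d, or not.
subsets : (n k : ℕ) → List (Fin k → Fin n)
subsets n       zero    = (λ ()) ∷ []
subsets zero    (suc k) = []
subsets (suc n) (suc k) =
  map (λ d → λ { zero → zero ; (suc i) → suc (d i) }) (subsets n k)
  ++ map (λ d i → suc (d i)) (subsets n (suc k))

sumℕ : ∀ {k} → (Fin k → ℕ) → ℕ
sumℕ {zero}  f = 0
sumℕ {suc k} f = f zero ℕ.+ sumℕ (λ i → f (suc i))

-- exponent Σ_{α=1}^k (d_α - α); with 0-based indices this is
-- Σ_{α} (toℕ (d α) - toℕ α), the same number.
sgnExp : ∀ {n k} → (Fin k → Fin n) → ℕ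
sgnExp d = sumℕ (λ α → toℕ (d α) ℕ.∸ toℕ α)

module _ {c ℓ} (F : Field c ℓ) where
  open Field F hiding (zero)

  Matrix : ℕ → ℕ → Set c
  Matrix n k = Fin n → Fin k → Carrier

  ∑ : ∀ {k} → (Fin k → Carrier) → Carrier
  ∑ {zero}  f = 0#
  ∑ {suc k} f = f zero + ∑ (λ i → f (suc i))

  ∑L : List Carrier → Carrier
  ∑L []       = 0#
  ∑L (x ∷ xs) = x + ∑L xs

  neg1^ : ℕ → Carrier
  neg1^ zero    = 1#
  neg1^ (suc m) = - neg1^ m

  sgn : ∀ {n k} → (Fin k → Fin n) → Carrier
  sgn d = neg1^ (sgnExp d)

  _⊗_ : ∀ {m n p} → Matrix m n → Matrix n p → Matrix m p
  (A ⊗ B) i j = ∑ (λ l → A i l * B l j)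

  det : ∀ {k} → Matrix k k → Carrier
  det {zero}  M = 1#
  det {suc k} M = ∑ (λ j → neg1^ (toℕ j) * (M zero j * det (λ i l → M (suc i) (punchIn j l))))

  cols : ∀ {n m k} → Matrix n m → (Fin k → Fin m) → Matrix n k
  cols A d i α = A i (d α)

  rows : ∀ {n m k} → Matrix n m → (Fin k → Fin n) → Matrix k m
  rows X d α j = X (d α) j

  cullis : ∀ {n k} → Matrix n k → Carrier
  cullis {n} {k} X = ∑L (map (λ d → sgn d * det (rows X d)) (subsets n k))

-- Both X ↦ cullis X and X ↦ cullis (A X B) are alternating multilinear forms in the columns of X,
-- and every such form D on n × k matrices obeys the generalised Cauchy–Binet expansion
-- D X = Σ_e det X[e|) · D (I(|e]) over the k-subsets e, so it is determined by its values on the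
-- column selections I(|e] of the identity.  There cullis (I(|d]) = sgn d, while the same expansion
-- gives cullis (M B) = cullis M · det B, so cullis (A I(|d] B) = cullis (A(|d]) · det B.

module Submission where

open import Level using (_⊔_)
open import Data.Nat as ℕ using (ℕ; zero; suc; _≤_; z≤n; s≤s)
open import Data.Nat.Properties using (≤-pred; ≤-refl; m≤n⇒m≤1+n; n≮0)
open import Data.Fin as Fin using (Fin; zero; suc; toℕ; punchIn; punchOut)
open import Data.Fin.Properties using (_≟_; 0≢1+n; suc-injective; punchInᵢ≢i; punchIn-punchOut; punchIn-injective; <⇒≢)
open import Data.List using (List; []; _∷_; _++_; map)
open import Data.List.Properties using (map-∘)
open import Data.List.Relation.Unary.All as All using (All; []; _∷_)
import Data.List.Relation.Unary.All.Properties as All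
open import Data.Product using (Σ; ∃₂; _,_; _×_)
open import Data.Sum using (_⊎_; inj₁; inj₂)
open import Data.Empty using (⊥-elim)
open import Function.Base using (_∘_)
open import Function.Bundles using (_⇔_; mk⇔)
open import Relation.Binary.Core using (_Preserves_⟶_)
open import Relation.Binary.PropositionalEquality as ≡ using (_≡_; _≢_; _≗_)
open import Relation.Nullary using (yes; no)
import Algebra.Properties.CommutativeSemigroup as CommutativeSemigroupProperties
import Algebra.Properties.Ring as RingProperties
import Algebra.Properties.Group as GroupProperties

open import Defs using (Field; StrictlyIncreasing; subsets; sumℕ)
import Defs

data Adjacent : ∀ {k} → Fin k → Fin k → Set where
  zero-one : ∀ {k} → Adjacent {suc (suc k)} zero (suc zero)
  suc-suc  : ∀ {k} {a b : Fin k} → Adjacent a b → Adjacent (suc a) (suc b)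

Adjacent-toℕ : ∀ {k} {a b : Fin k} → Adjacent a b → toℕ b ≡ suc (toℕ a)
Adjacent-toℕ zero-one    = ≡.refl
Adjacent-toℕ (suc-suc p) = ≡.cong suc (Adjacent-toℕ p)

Adjacent-punchOut : ∀ {k} {a b : Fin (suc k)} (j : Fin (suc k)) → Adjacent a b → j ≢ a → j ≢ b →
                    ∃₂ λ a′ b′ → Adjacent a′ b′ × punchIn j a′ ≡ a × punchIn j b′ ≡ b
Adjacent-punchOut zero                   zero-one j≢a j≢b = ⊥-elim (j≢a ≡.refl)
Adjacent-punchOut (suc zero)             zero-one j≢a j≢b = ⊥-elim (j≢b ≡.refl)
Adjacent-punchOut {suc (suc k)} (suc (suc j)) zero-one j≢a j≢b = zero , suc zero , zero-one , ≡.refl , ≡.refl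
Adjacent-punchOut zero (suc-suc {a = a} {b} p) j≢a j≢b = a , b , p , ≡.refl , ≡.refl
Adjacent-punchOut {suc k} (suc j) (suc-suc p) j≢a j≢b
  with Adjacent-punchOut j p (j≢a ∘ ≡.cong suc) (j≢b ∘ ≡.cong suc)
... | a′ , b′ , q , ja′≡a , jb′≡b = suc a′ , suc b′ , suc-suc q , ≡.cong suc ja′≡a , ≡.cong suc jb′≡b

Adjacent-punchIn : ∀ {k} {a b : Fin (suc k)} → Adjacent a b → ∀ l →
                   punchIn a l ≡ punchIn b l ⊎ (punchIn a l ≡ b × punchIn b l ≡ a)
Adjacent-punchIn zero-one zero    = inj₂ (≡.refl , ≡.refl)
Adjacent-punchIn zero-one (suc l) = inj₁ ≡.refl
Adjacent-punchIn {suc k} (suc-suc p) zero = inj₁ ≡.refl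
Adjacent-punchIn {suc k} (suc-suc p) (suc l) with Adjacent-punchIn p l
... | inj₁ eq         = inj₁ (≡.cong suc eq)
... | inj₂ (eqa , eqb) = inj₂ (≡.cong suc eqa , ≡.cong suc eqb)

withZero : ∀ {n k} → (Fin k → Fin n) → Fin (suc k) → Fin (suc n)
withZero d zero    = zero
withZero d (suc i) = suc (d i)

subsets-increasing : ∀ n k → All StrictlyIncreasing (subsets n k)
subsets-increasing n       zero    = (λ ()) ∷ []
subsets-increasing zero    (suc k) = []
subsets-increasing (suc n) (suc k) =
  All.++⁺ (All.map⁺ (All.map (λ d↑ → λ { zero (suc j) _ → s≤s z≤n ; (suc i) (suc j) (s≤s p) → s≤s (d↑ i j p) })
                             (subsets-increasing n k)))
          (All.map⁺ (All.map (λ d↑ i j p → s≤s (d↑ i j p)) (subsets-increasing n (suc k))))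

subsets-empty : ∀ n k → n ℕ.< k → subsets n k ≡ []
subsets-empty zero    (suc k) _       = ≡.refl
subsets-empty (suc n) (suc k) (s≤s p)
  rewrite subsets-empty n k p | subsets-empty n (suc k) (m≤n⇒m≤1+n p) = ≡.refl

sumℕ-cong : ∀ {k} {f g : Fin k → ℕ} → f ≗ g → sumℕ f ≡ sumℕ g
sumℕ-cong {zero}  f≗g = ≡.refl
sumℕ-cong {suc k} f≗g = ≡.cong₂ ℕ._+_ (f≗g zero) (sumℕ-cong (f≗g ∘ suc))

withZero-cong : ∀ {n k} {d d′ : Fin k → Fin n} → d ≗ d′ → withZero d ≗ withZero d′
withZero-cong d≗d′ zero    = ≡.refl
withZero-cong d≗d′ (suc i) = ≡.cong suc (d≗d′ i)

punchOut-increasing : ∀ {n k} {d : Fin k → Fin (suc n)} (0∉d : ∀ i → zero ≢ d i) →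
                      StrictlyIncreasing d → StrictlyIncreasing (λ i → punchOut (0∉d i))
punchOut-increasing 0∉d d↑ i j p =
  ≤-pred (≡.subst₂ Fin._<_ (≡.sym (punchIn-punchOut (0∉d i))) (≡.sym (punchIn-punchOut (0∉d j))) (d↑ i j p))

increasing-split : ∀ {n k} {d : Fin (suc k) → Fin (suc n)} → StrictlyIncreasing d →
                   (Σ (Fin k → Fin n) λ d′ → StrictlyIncreasing d′ × withZero d′ ≗ d)
                   ⊎ (Σ (Fin (suc k) → Fin n) λ d′ → StrictlyIncreasing d′ × suc ∘ d′ ≗ d)
increasing-split {d = d} d↑ with d zero in d₀
... | zero = inj₁ (_ , punchOut-increasing 0∉d (λ i j p → d↑ (suc i) (suc j) (s≤s p)) ,
                   λ { zero → ≡.sym d₀ ; (suc i) → punchIn-punchOut (0∉d i) })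
  where
  0∉d : ∀ i → zero ≢ d (suc i)
  0∉d i eq = <⇒≢ (d↑ zero (suc i) (s≤s z≤n)) (≡.trans d₀ eq)
... | suc _ = inj₂ (_ , punchOut-increasing 0∉d d↑ , λ i → punchIn-punchOut (0∉d i))
  where
  0∉d : ∀ i → zero ≢ d i
  0∉d zero    eq = 0≢1+n (≡.trans eq d₀)
  0∉d (suc i) eq = n≮0 (≡.subst (d zero Fin.<_) (≡.sym eq) (d↑ zero (suc i) (s≤s z≤n)))

module CullisDeterminant {c ℓ} (F : Field c ℓ) where

  open Field F hiding (zero)
  open import Relation.Binary.Reasoning.Setoid setoid
  open RingProperties ring using (-‿distribˡ-*; -‿distribʳ-*; -‿involutive; -1*x≈-x)
  open GroupProperties +-group using (inverseˡ-unique; identityˡ-unique)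
  open CommutativeSemigroupProperties +-commutativeSemigroup using (interchange) renaming (x∙yz≈y∙xz to +-leftComm)
  open CommutativeSemigroupProperties *-commutativeSemigroup using () renaming (x∙yz≈y∙xz to *-leftComm)

  Matrix : ℕ → ℕ → Set c
  Matrix = Defs.Matrix F

  ∑ : ∀ {k} → (Fin k → Carrier) → Carrier
  ∑ = Defs.∑ F

  ∑L : List Carrier → Carrier
  ∑L = Defs.∑L F

  neg1^ : ℕ → Carrier
  neg1^ = Defs.neg1^ F

  sgn : ∀ {n k} → (Fin k → Fin n) → Carrier
  sgn = Defs.sgn F

  infixl 7 _⊗_
  _⊗_ : ∀ {m n p} → Matrix m n → Matrix n p → Matrix m p
  _⊗_ = Defs._⊗_ F

  det : ∀ {k} → Matrix k k → Carrier
  det = Defs.det F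

  cols : ∀ {n m k} → Matrix n m → (Fin k → Fin m) → Matrix n k
  cols = Defs.cols F

  rows : ∀ {n m k} → Matrix n m → (Fin k → Fin n) → Matrix k m
  rows = Defs.rows F

  cullis : ∀ {n k} → Matrix n k → Carrier
  cullis = Defs.cullis F

  infix 4 _≋_
  _≋_ : ∀ {n k} → Matrix n k → Matrix n k → Set ℓ
  X ≋ Y = ∀ i j → X i j ≈ Y i j

  ∑-cong : ∀ {k} {f g : Fin k → Carrier} → (∀ i → f i ≈ g i) → ∑ f ≈ ∑ g
  ∑-cong {zero}  f≈g = refl
  ∑-cong {suc k} f≈g = +-cong (f≈g zero) (∑-cong (f≈g ∘ suc))

  ∑-zero : ∀ {k} {f : Fin k → Carrier} → (∀ i → f i ≈ 0#) → ∑ f ≈ 0#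
  ∑-zero {zero}  f≈0 = refl
  ∑-zero {suc k} f≈0 = trans (+-cong (f≈0 zero) (∑-zero (f≈0 ∘ suc))) (+-identityʳ 0#)

  ∑-distrib-+ : ∀ {k} (f g : Fin k → Carrier) → ∑ (λ i → f i + g i) ≈ ∑ f + ∑ g
  ∑-distrib-+ {zero}  f g = sym (+-identityʳ 0#)
  ∑-distrib-+ {suc k} f g = trans (+-congˡ (∑-distrib-+ (f ∘ suc) (g ∘ suc))) (interchange _ _ _ _)

  *-distribˡ-∑ : ∀ {k} a (f : Fin k → Carrier) → a * ∑ f ≈ ∑ (λ i → a * f i)
  *-distribˡ-∑ {zero}  a f = zeroʳ a
  *-distribˡ-∑ {suc k} a f = trans (distribˡ a _ _) (+-congˡ (*-distribˡ-∑ a (f ∘ suc)))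

  *-distribʳ-∑ : ∀ {k} a (f : Fin k → Carrier) → ∑ f * a ≈ ∑ (λ i → f i * a)
  *-distribʳ-∑ a f = trans (*-comm _ a) (trans (*-distribˡ-∑ a f) (∑-cong λ i → *-comm a (f i)))

  ∑-linear : ∀ {k} a {f g h : Fin k → Carrier} → (∀ i → f i ≈ a * g i + h i) → ∑ f ≈ a * ∑ g + ∑ h
  ∑-linear a {f} {g} {h} f≈ = begin
    ∑ f                               ≈⟨ ∑-cong f≈ ⟩
    ∑ (λ i → a * g i + h i)           ≈⟨ ∑-distrib-+ _ h ⟩
    ∑ (λ i → a * g i) + ∑ h           ≈⟨ +-congʳ (*-distribˡ-∑ a g) ⟨
    a * ∑ g + ∑ h                     ∎

  module _ {a} {A : Set a} where

    ∑L-cong : ∀ (xs : List A) {f g : A → Carrier} → (∀ x → f x ≈ g x) → ∑L (map f xs) ≈ ∑L (map g xs)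
    ∑L-cong []       f≈g = refl
    ∑L-cong (x ∷ xs) f≈g = +-cong (f≈g x) (∑L-cong xs f≈g)

    ∑L-cong-All : ∀ {p} {P : A → Set p} {xs : List A} {f g : A → Carrier} →
                  All P xs → (∀ x → P x → f x ≈ g x) → ∑L (map f xs) ≈ ∑L (map g xs)
    ∑L-cong-All []         f≈g = refl
    ∑L-cong-All (px ∷ pxs) f≈g = +-cong (f≈g _ px) (∑L-cong-All pxs f≈g)

    ∑L-zero : ∀ (xs : List A) {f : A → Carrier} → (∀ x → f x ≈ 0#) → ∑L (map f xs) ≈ 0#
    ∑L-zero []       f≈0 = refl
    ∑L-zero (x ∷ xs) f≈0 = trans (+-cong (f≈0 x) (∑L-zero xs f≈0)) (+-identityʳ 0#)

    ∑L-++ : ∀ (xs ys : List A) (f : A → Carrier) → ∑L (map f (xs ++ ys)) ≈ ∑L (map f xs) + ∑L (map f ys)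
    ∑L-++ []       ys f = sym (+-identityˡ _)
    ∑L-++ (x ∷ xs) ys f = trans (+-congˡ (∑L-++ xs ys f)) (sym (+-assoc _ _ _))

    ∑L-distrib-+ : ∀ (xs : List A) (f g : A → Carrier) → ∑L (map (λ x → f x + g x) xs) ≈ ∑L (map f xs) + ∑L (map g xs)
    ∑L-distrib-+ []       f g = sym (+-identityʳ 0#)
    ∑L-distrib-+ (x ∷ xs) f g = trans (+-congˡ (∑L-distrib-+ xs f g)) (interchange _ _ _ _)

    *-distribˡ-∑L : ∀ (xs : List A) a (f : A → Carrier) → a * ∑L (map f xs) ≈ ∑L (map (λ x → a * f x) xs)
    *-distribˡ-∑L []       a f = zeroʳ a
    *-distribˡ-∑L (x ∷ xs) a f = trans (distribˡ a _ _) (+-congˡ (*-distribˡ-∑L xs a f))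

    *-distribʳ-∑L : ∀ (xs : List A) a (f : A → Carrier) → ∑L (map f xs) * a ≈ ∑L (map (λ x → f x * a) xs)
    *-distribʳ-∑L xs a f = trans (*-comm _ a) (trans (*-distribˡ-∑L xs a f) (∑L-cong xs (λ x → *-comm a (f x))))

    ∑L-linear : ∀ (xs : List A) a {f g h : A → Carrier} → (∀ x → f x ≈ a * g x + h x) →
                ∑L (map f xs) ≈ a * ∑L (map g xs) + ∑L (map h xs)
    ∑L-linear xs a {f} {g} {h} f≈ = begin
      ∑L (map f xs)                                  ≈⟨ ∑L-cong xs f≈ ⟩
      ∑L (map (λ x → a * g x + h x) xs)              ≈⟨ ∑L-distrib-+ xs _ h ⟩
      ∑L (map (λ x → a * g x) xs) + ∑L (map h xs)    ≈⟨ +-congʳ (*-distribˡ-∑L xs a g) ⟨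
      a * ∑L (map g xs) + ∑L (map h xs)              ∎

    ∑L-∑-comm : ∀ (xs : List A) {k} (f : A → Fin k → Carrier) →
                ∑L (map (λ x → ∑ (f x)) xs) ≈ ∑ (λ j → ∑L (map (λ x → f x j) xs))
    ∑L-∑-comm []       {k} f = sym (∑-zero {k} (λ _ → refl))
    ∑L-∑-comm (x ∷ xs) f = trans (+-congˡ (∑L-∑-comm xs f)) (sym (∑-distrib-+ (f x) _))

    ∑L-map : ∀ {b} {B : Set b} (xs : List B) (g : B → A) (f : A → Carrier) →
             ∑L (map f (map g xs)) ≈ ∑L (map (f ∘ g) xs)
    ∑L-map xs g f = reflexive (≡.cong ∑L (≡.sym (map-∘ xs)))

  *-linear : ∀ s {u a v w} → u ≈ a * v + w → s * u ≈ a * (s * v) + s * w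
  *-linear s {u} {a} {v} {w} u≈ = begin
    s * u                  ≈⟨ *-congˡ u≈ ⟩
    s * (a * v + w)        ≈⟨ distribˡ s _ _ ⟩
    s * (a * v) + s * w    ≈⟨ +-congʳ (*-leftComm s a v) ⟩
    a * (s * v) + s * w    ∎

  I : ∀ {n} → Matrix n n
  I zero    zero    = 1#
  I zero    (suc _) = 0#
  I (suc _) zero    = 0#
  I (suc i) (suc j) = I i j

  ⊗-identityʳ : ∀ {m n} (A : Matrix m n) → A ⊗ I ≋ A
  ⊗-identityʳ A i = ∑-*-I (A i)
    where
    ∑-*-I : ∀ {n} (g : Fin n → Carrier) j → ∑ (λ l → g l * I l j) ≈ g j
    ∑-*-I g zero    = trans (+-cong (*-identityʳ _) (∑-zero (λ l → zeroʳ (g (suc l))))) (+-identityʳ _)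
    ∑-*-I g (suc j) = trans (+-cong (zeroʳ _) (∑-*-I (g ∘ suc) j)) (+-identityˡ _)

  AgreeOff : ∀ {n k} → Fin k → Matrix n k → Matrix n k → Set ℓ
  AgreeOff c X Y = ∀ i β → β ≢ c → X i β ≈ Y i β

  minor : ∀ {m k} → Matrix (suc m) (suc k) → Fin (suc k) → Matrix m k
  minor M j i l = M (suc i) (punchIn j l)

  expansionTerm : ∀ {k} → Matrix (suc k) (suc k) → Fin (suc k) → Carrier
  expansionTerm M j = neg1^ (toℕ j) * (M zero j * det (minor M j))

  det-cong : ∀ {k} {X Y : Matrix k k} → X ≋ Y → det X ≈ det Y
  det-cong {zero}  X≋Y = refl
  det-cong {suc k} X≋Y = ∑-cong λ j → *-congˡ {neg1^ (toℕ j)} (*-cong (X≋Y zero j) (det-cong λ i l → X≋Y (suc i) (punchIn j l)))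

  det-linear : ∀ {k} (c : Fin k) a (X Y Z : Matrix k k) → (∀ i → X i c ≈ a * Y i c + Z i c) →
               AgreeOff c X Y → AgreeOff c X Z → det X ≈ a * det Y + det Z
  det-linear {suc k} c a X Y Z Xc≈ X≈Y X≈Z = ∑-linear a (λ j → *-linear (neg1^ (toℕ j)) (term j))
    where
    term : ∀ j → X zero j * det (minor X j) ≈ a * (Y zero j * det (minor Y j)) + Z zero j * det (minor Z j)
    term j with j ≟ c
    ... | yes ≡.refl = begin
      X zero j * det (minor X j)                                ≈⟨ *-congʳ (Xc≈ zero) ⟩
      (a * Y zero j + Z zero j) * det (minor X j)               ≈⟨ distribʳ _ _ _ ⟩
      a * Y zero j * det (minor X j) + Z zero j * det (minor X j)
        ≈⟨ +-cong (trans (*-assoc _ _ _) (*-congˡ (*-congˡ (minor≈ X≈Y)))) (*-congˡ (minor≈ X≈Z)) ⟩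
      a * (Y zero j * det (minor Y j)) + Z zero j * det (minor Z j) ∎
      where
      minor≈ : ∀ {W} → AgreeOff c X W → det (minor X j) ≈ det (minor W j)
      minor≈ X≈W = det-cong λ i l → X≈W (suc i) (punchIn j l) (punchInᵢ≢i j l)
    ... | no j≢c = begin
      X zero j * det (minor X j)                                ≈⟨ *-linear (X zero j) (det-linear c′ a _ _ _ Xc′≈ (minor≈ X≈Y) (minor≈ X≈Z)) ⟩
      a * (X zero j * det (minor Y j)) + X zero j * det (minor Z j)
        ≈⟨ +-cong (*-congˡ (*-congʳ (X≈Y zero j j≢c))) (*-congʳ (X≈Z zero j j≢c)) ⟩
      a * (Y zero j * det (minor Y j)) + Z zero j * det (minor Z j) ∎
      where
      c′ = punchOut j≢c
      Xc′≈ : ∀ i → minor X j i c′ ≈ a * minor Y j i c′ + minor Z j i c′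
      Xc′≈ i rewrite punchIn-punchOut j≢c = Xc≈ (suc i)
      minor≈ : ∀ {W} → AgreeOff c X W → AgreeOff c′ (minor X j) (minor W j)
      minor≈ X≈W i β β≢c′ = X≈W (suc i) (punchIn j β)
        λ eq → β≢c′ (punchIn-injective j β c′ (≡.trans eq (≡.sym (punchIn-punchOut j≢c))))

  ∑-adjacent : ∀ {k} {a b : Fin k} (f : Fin k → Carrier) → Adjacent a b →
               (∀ j → j ≢ a → j ≢ b → f j ≈ 0#) → f a + f b ≈ 0# → ∑ f ≈ 0#
  ∑-adjacent {suc (suc k)} f zero-one f≈0 fa+fb≈0 = begin
    f zero + (f (suc zero) + ∑ {k} (λ j → f (suc (suc j))))
      ≈⟨ +-congˡ (+-congˡ (∑-zero λ j → f≈0 (suc (suc j)) (λ ()) (λ ()))) ⟩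
    f zero + (f (suc zero) + 0#)   ≈⟨ +-congˡ (+-identityʳ _) ⟩
    f zero + f (suc zero)          ≈⟨ fa+fb≈0 ⟩
    0#                             ∎
  ∑-adjacent f (suc-suc a~b) f≈0 fa+fb≈0 =
    trans (+-cong (f≈0 zero (λ ()) (λ ())) (∑-adjacent (f ∘ suc) a~b f∘suc≈0 fa+fb≈0)) (+-identityʳ 0#)
    where
    f∘suc≈0 : ∀ j → j ≢ _ → j ≢ _ → f (suc j) ≈ 0#
    f∘suc≈0 j j≢a j≢b = f≈0 (suc j) (j≢a ∘ suc-injective) (j≢b ∘ suc-injective)

  -- Expanding along the first row, every other minor still has two equal adjacent columns,
  -- and the terms of the two equal columns cancel.
  det-alternating : ∀ {k} (X : Matrix k k) {a b} → Adjacent a b → (∀ i → X i a ≈ X i b) → det X ≈ 0#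
  det-alternating {suc k} X {a} {b} a~b Xa≈Xb = ∑-adjacent (expansionTerm X) a~b others cancel
    where
    others : ∀ j → j ≢ a → j ≢ b → expansionTerm X j ≈ 0#
    others j j≢a j≢b with Adjacent-punchOut j a~b j≢a j≢b
    ... | a′ , b′ , a′~b′ , ja′≡a , jb′≡b =
      trans (*-congˡ (trans (*-congˡ (det-alternating (minor X j) a′~b′ Xa′≈Xb′)) (zeroʳ _))) (zeroʳ _)
      where
      Xa′≈Xb′ : ∀ i → minor X j i a′ ≈ minor X j i b′
      Xa′≈Xb′ i rewrite ja′≡a | jb′≡b = Xa≈Xb (suc i)
    minor≋ : minor X b ≋ minor X a
    minor≋ i l with Adjacent-punchIn a~b l
    ... | inj₁ eq = reflexive (≡.cong (X (suc i)) (≡.sym eq))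
    ... | inj₂ (eqa , eqb) rewrite eqa | eqb = Xa≈Xb (suc i)
    cancel : expansionTerm X a + expansionTerm X b ≈ 0#
    cancel = begin
      expansionTerm X a + neg1^ (toℕ b) * (X zero b * det (minor X b))
        ≈⟨ +-congˡ (*-cong (reflexive (≡.cong neg1^ (Adjacent-toℕ a~b))) (*-cong (sym (Xa≈Xb zero)) (det-cong minor≋))) ⟩
      expansionTerm X a + - neg1^ (toℕ a) * (X zero a * det (minor X a))
        ≈⟨ +-congˡ (sym (-‿distribˡ-* _ _)) ⟩
      expansionTerm X a - expansionTerm X a ≈⟨ -‿inverseʳ _ ⟩
      0# ∎

  -- Alternation is only asked of adjacent columns; that is all the expansion below needs.
  record IsAlternatingMultilinear {n k} (D : Matrix n k → Carrier) : Set (c ⊔ ℓ) where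
    field
      cong        : ∀ {X Y} → X ≋ Y → D X ≈ D Y
      linear      : ∀ (j : Fin k) a (X Y Z : Matrix n k) → (∀ i → X i j ≈ a * Y i j + Z i j) →
                    AgreeOff j X Y → AgreeOff j X Z → D X ≈ a * D Y + D Z
      alternating : ∀ (X : Matrix n k) {a b} → Adjacent a b → (∀ i → X i a ≈ X i b) → D X ≈ 0#

    additive : ∀ (j : Fin k) (X Y Z : Matrix n k) → (∀ i → X i j ≈ Y i j + Z i j) →
               AgreeOff j X Y → AgreeOff j X Z → D X ≈ D Y + D Z
    additive j X Y Z Xj≈ X≈Y X≈Z =
      trans (linear j 1# X Y Z (λ i → trans (Xj≈ i) (+-congʳ (sym (*-identityˡ _)))) X≈Y X≈Z)
            (+-congʳ (*-identityˡ _))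

    zeroColumn : ∀ X (j : Fin k) → (∀ i → X i j ≈ 0#) → D X ≈ 0#
    zeroColumn X j Xj≈0 = identityˡ-unique (D X) (D X) (sym (additive j X X X Xj≈Xj+Xj (λ _ _ _ → refl) (λ _ _ _ → refl)))
      where
      Xj≈Xj+Xj : ∀ i → X i j ≈ X i j + X i j
      Xj≈Xj+Xj i = trans (Xj≈0 i) (sym (trans (+-cong (Xj≈0 i) (Xj≈0 i)) (+-identityʳ 0#)))

  det-alternatingMultilinear : ∀ {k} → IsAlternatingMultilinear (det {k})
  det-alternatingMultilinear = record { cong = det-cong ; linear = det-linear ; alternating = det-alternating }

  infixr 5 _▹_
  _▹_ : ∀ {n k} → (Fin n → Carrier) → Matrix n k → Matrix n (suc k)
  (v ▹ Y) i zero    = v i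
  (v ▹ Y) i (suc β) = Y i β

  headCol : ∀ {n k} → Matrix n (suc k) → Fin n → Carrier
  headCol W i = W i zero

  tailCols : ∀ {n k} → Matrix n (suc k) → Matrix n k
  tailCols W i β = W i (suc β)

  ▹-agreeOff-zero : ∀ {n k} {v w : Fin n → Carrier} (Y : Matrix n k) → AgreeOff zero (v ▹ Y) (w ▹ Y)
  ▹-agreeOff-zero Y i zero    β≢0 = ⊥-elim (β≢0 ≡.refl)
  ▹-agreeOff-zero Y i (suc β) _   = refl

  ▹-agreeOff-suc : ∀ {n k} (v : Fin n → Carrier) {Y Y′ : Matrix n k} {j} → AgreeOff j Y Y′ → AgreeOff (suc j) (v ▹ Y) (v ▹ Y′)
  ▹-agreeOff-suc v Y≈Y′ i zero    _     = refl
  ▹-agreeOff-suc v Y≈Y′ i (suc β) β≢1+j = Y≈Y′ i β (β≢1+j ∘ ≡.cong suc)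

  padTop : ∀ {n k} → Matrix n k → Matrix (suc n) k
  padTop Y zero    β = 0#
  padTop Y (suc i) β = Y i β

  clearTop : ∀ {n k} → Matrix (suc n) k → Matrix (suc n) k
  clearTop X = padTop (X ∘ suc)

  e₀ : ∀ {n} → Fin (suc n) → Carrier
  e₀ i = I i zero

  ▹-alternatingMultilinear : ∀ {n k} {D : Matrix n (suc k) → Carrier} → IsAlternatingMultilinear D →
                             ∀ v → IsAlternatingMultilinear (λ Y → D (v ▹ Y))
  ▹-alternatingMultilinear D-am v = record
    { cong        = λ Y≋Y′ → cong λ { i zero → refl ; i (suc β) → Y≋Y′ i β }
    ; linear      = λ j a X Y Z Xj≈ X≈Y X≈Z →
                      linear (suc j) a (v ▹ X) (v ▹ Y) (v ▹ Z) Xj≈ (▹-agreeOff-suc v X≈Y) (▹-agreeOff-suc v X≈Z)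
    ; alternating = λ X a~b Xa≈Xb → alternating (v ▹ X) (suc-suc a~b) Xa≈Xb
    }
    where open IsAlternatingMultilinear D-am

  -- With no rows, every column is vacuously -1 times itself plus itself.
  noRows-zero : ∀ {k} {D : Matrix 0 (suc k) → Carrier} → IsAlternatingMultilinear D → ∀ X → D X ≈ 0#
  noRows-zero {D = D} D-am X = begin
    D X                ≈⟨ linear zero (- 1#) X X X (λ ()) (λ ()) (λ ()) ⟩
    - 1# * D X + D X   ≈⟨ +-congʳ (-1*x≈-x _) ⟩
    - D X + D X        ≈⟨ -‿inverseˡ _ ⟩
    0#                 ∎
    where open IsAlternatingMultilinear D-am

  -- D (u+v ▹ u+v ▹ Y) = 0 expands into the four terms below, two of which vanish.
  swap-first-two : ∀ {n k} {D : Matrix n (suc (suc k)) → Carrier} → IsAlternatingMultilinear D →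
                   ∀ u v Y → D (u ▹ v ▹ Y) ≈ - D (v ▹ u ▹ Y)
  swap-first-two {n} {k} {D} D-am u v Y = inverseˡ-unique _ _ (begin
    D (u ▹ v ▹ Y) + D (v ▹ u ▹ Y)
      ≈⟨ +-cong (sym (trans (+-congʳ (twice u)) (+-identityˡ _))) (sym (trans (+-congˡ (twice v)) (+-identityʳ _))) ⟩
    (D (u ▹ u ▹ Y) + D (u ▹ v ▹ Y)) + (D (v ▹ u ▹ Y) + D (v ▹ v ▹ Y))
      ≈⟨ +-cong (sym (split₁ u)) (sym (split₁ v)) ⟩
    D (u ▹ s ▹ Y) + D (v ▹ s ▹ Y)
      ≈⟨ additive zero (s ▹ s ▹ Y) (u ▹ s ▹ Y) (v ▹ s ▹ Y) (λ _ → refl) (▹-agreeOff-zero _) (▹-agreeOff-zero _) ⟨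
    D (s ▹ s ▹ Y) ≈⟨ twice s ⟩
    0# ∎)
    where
    open IsAlternatingMultilinear D-am
    s : Fin n → Carrier
    s i = u i + v i
    twice : ∀ w → D (w ▹ w ▹ Y) ≈ 0#
    twice w = alternating (w ▹ w ▹ Y) zero-one (λ _ → refl)
    split₁ : ∀ w → D (w ▹ s ▹ Y) ≈ D (w ▹ u ▹ Y) + D (w ▹ v ▹ Y)
    split₁ w = additive (suc zero) (w ▹ s ▹ Y) (w ▹ u ▹ Y) (w ▹ v ▹ Y) (λ _ → refl)
                 (▹-agreeOff-suc w (▹-agreeOff-zero Y)) (▹-agreeOff-suc w (▹-agreeOff-zero Y))

  padTop-alternatingMultilinear : ∀ {n k} {D : Matrix (suc n) k → Carrier} → IsAlternatingMultilinear D →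
                                  IsAlternatingMultilinear (D ∘ padTop)
  padTop-alternatingMultilinear D-am = record
    { cong        = λ Y≋Y′ → cong λ { zero β → refl ; (suc i) β → Y≋Y′ i β }
    ; linear      = λ j a X Y Z Xj≈ X≈Y X≈Z → linear j a (padTop X) (padTop Y) (padTop Z)
                      (λ { zero → sym (trans (+-congʳ (zeroʳ a)) (+-identityʳ 0#)) ; (suc i) → Xj≈ i })
                      (λ { zero β _ → refl ; (suc i) → X≈Y i })
                      (λ { zero β _ → refl ; (suc i) → X≈Z i })
    ; alternating = λ X a~b Xa≈Xb → alternating (padTop X) a~b λ { zero → refl ; (suc i) → Xa≈Xb i }
    }
    where open IsAlternatingMultilinear D-am

  top-split : ∀ {n k} (X : Matrix (suc n) (suc k)) i → X i zero ≈ X zero zero * e₀ i + clearTop X i zero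
  top-split X zero    = sym (trans (+-congʳ (*-identityʳ _)) (+-identityʳ _))
  top-split X (suc i) = sym (trans (+-congʳ (zeroʳ _)) (+-identityˡ _))

  -- Clearing the top entry of a column subtracts a multiple of e₀ from it, which an alternating
  -- form does not notice once that column has been swapped next to e₀.
  clearTop-beside-e₀ : ∀ {n k} {D : Matrix (suc n) (suc k) → Carrier} → IsAlternatingMultilinear D →
                       ∀ Y → D (e₀ ▹ Y) ≈ D (e₀ ▹ clearTop Y)
  clearTop-beside-e₀ {k = zero} D-am Y = IsAlternatingMultilinear.cong D-am λ { i zero → refl ; i (suc ()) }
  clearTop-beside-e₀ {n} {suc k} {D} D-am Y = begin
    D (e₀ ▹ Y)
      ≈⟨ linear (suc zero) (Y zero zero) _ (e₀ ▹ e₀ ▹ tailCols Y) (e₀ ▹ y′ ▹ tailCols Y) (top-split Y) (agree e₀) (agree y′) ⟩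
    Y zero zero * D (e₀ ▹ e₀ ▹ tailCols Y) + D (e₀ ▹ y′ ▹ tailCols Y)
      ≈⟨ +-congʳ (trans (*-congˡ (alternating _ zero-one λ _ → refl)) (zeroʳ _)) ⟩
    0# + D (e₀ ▹ y′ ▹ tailCols Y)              ≈⟨ +-identityˡ _ ⟩
    D (e₀ ▹ y′ ▹ tailCols Y)                   ≈⟨ swap-first-two D-am e₀ y′ (tailCols Y) ⟩
    - D (y′ ▹ e₀ ▹ tailCols Y)                 ≈⟨ -‿cong (clearTop-beside-e₀ (▹-alternatingMultilinear D-am y′) (tailCols Y)) ⟩
    - D (y′ ▹ e₀ ▹ clearTop (tailCols Y))      ≈⟨ -‿cong (swap-first-two D-am y′ e₀ _) ⟩
    - - D (e₀ ▹ y′ ▹ clearTop (tailCols Y))    ≈⟨ -‿involutive _ ⟩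
    D (e₀ ▹ y′ ▹ clearTop (tailCols Y))
      ≈⟨ cong (λ { i zero → refl ; zero (suc zero) → refl ; (suc i) (suc zero) → refl
                 ; zero (suc (suc β)) → refl ; (suc i) (suc (suc β)) → refl }) ⟩
    D (e₀ ▹ clearTop Y)                        ∎
    where
    open IsAlternatingMultilinear D-am
    y′ : Fin (suc n) → Carrier
    y′ = headCol (clearTop Y)
    agree : ∀ w → AgreeOff (suc zero) (e₀ ▹ Y) (e₀ ▹ w ▹ tailCols Y)
    agree w i zero          _   = refl
    agree w i (suc zero)    β≢1 = ⊥-elim (β≢1 ≡.refl)
    agree w i (suc (suc β)) _   = refl

  setCol : ∀ {n k} → Matrix n k → Fin k → (Fin n → Carrier) → Matrix n k
  setCol W zero    v = v ▹ tailCols W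
  setCol W (suc α) v = headCol W ▹ setCol (tailCols W) α v

  setCol-cong : ∀ {n k} {W W′ : Matrix n k} α v → W ≋ W′ → setCol W α v ≋ setCol W′ α v
  setCol-cong zero    v W≋W′ i zero    = refl
  setCol-cong zero    v W≋W′ i (suc β) = W≋W′ i (suc β)
  setCol-cong (suc α) v W≋W′ i zero    = W≋W′ i zero
  setCol-cong (suc α) v W≋W′ i (suc β) = setCol-cong α v (λ i′ β′ → W≋W′ i′ (suc β′)) i β

  -- Split the first column as (top entry) · e₀ + (the rest) and recurse on the remaining columns;
  -- beside e₀ those columns may be cleared at once by clearTop-beside-e₀.
  expand-top-row : ∀ {n k} {D : Matrix (suc n) k → Carrier} → IsAlternatingMultilinear D → ∀ X →
                   D X ≈ D (clearTop X) + ∑ (λ α → X zero α * D (setCol (clearTop X) α e₀))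
  expand-top-row {k = zero} D-am X = trans (IsAlternatingMultilinear.cong D-am λ i ()) (sym (+-identityʳ _))
  expand-top-row {n} {suc k} {D} D-am X = begin
    D X
      ≈⟨ linear zero (X zero zero) X (e₀ ▹ tailCols X) (x′ ▹ tailCols X) (top-split X) (agree e₀) (agree x′) ⟩
    X zero zero * D (e₀ ▹ tailCols X) + D (x′ ▹ tailCols X)
      ≈⟨ +-cong (*-congˡ (trans (clearTop-beside-e₀ D-am (tailCols X)) (cong clear-e₀))) rest ⟩
    X zero zero * D (setCol (clearTop X) zero e₀) + (D (clearTop X) + ∑ (λ β → X zero (suc β) * D (setCol (clearTop X) (suc β) e₀)))
      ≈⟨ +-leftComm _ _ _ ⟩
    D (clearTop X) + ∑ (λ α → X zero α * D (setCol (clearTop X) α e₀)) ∎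
    where
    open IsAlternatingMultilinear D-am
    x′ : Fin (suc n) → Carrier
    x′ = headCol (clearTop X)
    agree : ∀ w → AgreeOff zero X (w ▹ tailCols X)
    agree w i zero    β≢0 = ⊥-elim (β≢0 ≡.refl)
    agree w i (suc β) _   = refl
    clear-e₀ : e₀ ▹ clearTop (tailCols X) ≋ e₀ ▹ tailCols (clearTop X)
    clear-e₀ i       zero    = refl
    clear-e₀ zero    (suc β) = refl
    clear-e₀ (suc i) (suc β) = refl
    clear-tail : clearTop (tailCols X) ≋ tailCols (clearTop X)
    clear-tail zero    β = refl
    clear-tail (suc i) β = refl
    rest : D (x′ ▹ tailCols X) ≈ D (clearTop X) + ∑ (λ β → X zero (suc β) * D (setCol (clearTop X) (suc β) e₀))
    rest = trans (expand-top-row (▹-alternatingMultilinear D-am x′) (tailCols X))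
                 (+-cong (cong λ { zero zero → refl ; (suc i) zero → refl ; zero (suc β) → refl ; (suc i) (suc β) → refl })
                         (∑-cong λ β → *-congˡ (cong λ { i zero → refl ; i (suc γ) → setCol-cong β e₀ clear-tail i γ })))

  dropCol : ∀ {n k} → Matrix n (suc k) → Fin (suc k) → Matrix n k
  dropCol W α i β = W i (punchIn α β)

  setCol-to-front : ∀ {n k} {D : Matrix n (suc k) → Carrier} → IsAlternatingMultilinear D → ∀ W α v →
                    D (setCol W α v) ≈ neg1^ (toℕ α) * D (v ▹ dropCol W α)
  setCol-to-front D-am W zero v = sym (*-identityˡ _)
  setCol-to-front {n} {suc k} {D} D-am W (suc α) v = begin
    D (headCol W ▹ setCol (tailCols W) α v)
      ≈⟨ setCol-to-front (▹-alternatingMultilinear D-am (headCol W)) (tailCols W) α v ⟩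
    neg1^ (toℕ α) * D (headCol W ▹ v ▹ dropCol (tailCols W) α)
      ≈⟨ *-congˡ (swap-first-two D-am (headCol W) v _) ⟩
    neg1^ (toℕ α) * - D (v ▹ headCol W ▹ dropCol (tailCols W) α)
      ≈⟨ *-congˡ (-‿cong (cong λ { i zero → refl ; i (suc zero) → refl ; i (suc (suc β)) → refl })) ⟩
    neg1^ (toℕ α) * - D (v ▹ dropCol W (suc α))
      ≈⟨ -‿distribʳ-* _ _ ⟨
    - (neg1^ (toℕ α) * D (v ▹ dropCol W (suc α)))
      ≈⟨ -‿distribˡ-* _ _ ⟩
    - neg1^ (toℕ α) * D (v ▹ dropCol W (suc α)) ∎
    where open IsAlternatingMultilinear D-am

  ∑L-subsets-suc : ∀ n k (f : (Fin (suc k) → Fin (suc n)) → Carrier) → f Preserves _≗_ ⟶ _≈_ →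
                   ∑L (map f (subsets (suc n) (suc k)))
                     ≈ ∑L (map (f ∘ withZero) (subsets n k)) + ∑L (map (λ d → f (suc ∘ d)) (subsets n (suc k)))
  ∑L-subsets-suc n k f f-resp = trans (∑L-++ (map _ (subsets n k)) _ f)
    (+-cong (trans (∑L-map (subsets n k) _ f) (∑L-cong (subsets n k) λ d → f-resp λ { zero → ≡.refl ; (suc i) → ≡.refl }))
            (∑L-map (subsets n (suc k)) _ f))

  HasExpansion : ℕ → ℕ → Set (c ⊔ ℓ)
  HasExpansion n k = ∀ {D : Matrix n k → Carrier} → IsAlternatingMultilinear D → ∀ X →
                     D X ≈ ∑L (map (λ e → det (rows X e) * D (cols I e)) (subsets n k))

  -- Moving column α to the front and expanding the form D (e₀ ▹ padTop _) of its minor yields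
  -- exactly the first-row expansion terms of det X[0 ∷ 1+e|).
  expand-top-row-terms : ∀ {n k} → HasExpansion n k → {D : Matrix (suc n) (suc k) → Carrier} →
                         IsAlternatingMultilinear D → ∀ X →
                         ∑ (λ α → X zero α * D (setCol (clearTop X) α e₀))
                           ≈ ∑L (map (λ e → det (rows X (withZero e)) * D (cols I (withZero e))) (subsets n k))
  expand-top-row-terms {n} {k} expand {D} D-am X = begin
    ∑ (λ α → X zero α * D (setCol (clearTop X) α e₀))
      ≈⟨ ∑-cong term ⟩
    ∑ {suc k} (λ α → ∑L (map (λ e → expansionTerm (rows X (withZero e)) α * g e) (subsets n k)))
      ≈⟨ ∑L-∑-comm (subsets n k) (λ e α → expansionTerm (rows X (withZero e)) α * g e) ⟨
    ∑L (map (λ e → ∑ {suc k} (λ α → expansionTerm (rows X (withZero e)) α * g e)) (subsets n k))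
      ≈⟨ ∑L-cong (subsets n k) (λ e → sym (*-distribʳ-∑ (g e) (expansionTerm (rows X (withZero e))))) ⟩
    ∑L (map (λ e → det (rows X (withZero e)) * g e) (subsets n k)) ∎
    where
    open IsAlternatingMultilinear D-am
    G : Matrix n k → Carrier
    G Y = D (e₀ ▹ padTop Y)
    G-am : IsAlternatingMultilinear G
    G-am = padTop-alternatingMultilinear (▹-alternatingMultilinear D-am e₀)
    g : (Fin k → Fin n) → Carrier
    g e = D (cols I (withZero e))
    G≈g : ∀ e → G (cols I e) ≈ g e
    G≈g e = cong λ { i zero → refl ; zero (suc β) → refl ; (suc i) (suc β) → refl }
    term : ∀ α → X zero α * D (setCol (clearTop X) α e₀)
                   ≈ ∑L (map (λ e → expansionTerm (rows X (withZero e)) α * g e) (subsets n k))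
    term α = begin
      X zero α * D (setCol (clearTop X) α e₀)
        ≈⟨ *-congˡ (setCol-to-front D-am (clearTop X) α e₀) ⟩
      X zero α * (neg1^ (toℕ α) * D (e₀ ▹ dropCol (clearTop X) α))
        ≈⟨ *-congˡ (*-congˡ (cong λ { i zero → refl ; zero (suc β) → refl ; (suc i) (suc β) → refl })) ⟩
      X zero α * (neg1^ (toℕ α) * G (minor X α))
        ≈⟨ *-leftComm _ _ _ ⟩
      neg1^ (toℕ α) * (X zero α * G (minor X α))
        ≈⟨ *-congˡ (*-congˡ (expand G-am (minor X α))) ⟩
      neg1^ (toℕ α) * (X zero α * ∑L (map (λ e → det (rows (minor X α) e) * G (cols I e)) (subsets n k)))
        ≈⟨ *-congˡ (*-distribˡ-∑L (subsets n k) _ _) ⟩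
      neg1^ (toℕ α) * ∑L (map (λ e → X zero α * (det (rows (minor X α) e) * G (cols I e))) (subsets n k))
        ≈⟨ *-distribˡ-∑L (subsets n k) _ _ ⟩
      ∑L (map (λ e → neg1^ (toℕ α) * (X zero α * (det (rows (minor X α) e) * G (cols I e)))) (subsets n k))
        ≈⟨ ∑L-cong (subsets n k) (λ e → trans (*-congˡ (sym (*-assoc _ _ _))) (trans (sym (*-assoc _ _ _)) (*-congˡ (G≈g e)))) ⟩
      ∑L (map (λ e → expansionTerm (rows X (withZero e)) α * g e) (subsets n k)) ∎

  expansion : ∀ n k → HasExpansion n k
  expansion n       zero    D-am X = sym (trans (+-identityʳ _) (trans (*-identityˡ _) (IsAlternatingMultilinear.cong D-am λ i ())))
  expansion zero    (suc k) D-am X = noRows-zero D-am X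
  expansion (suc n) (suc k) {D} D-am X = begin
    D X                                                     ≈⟨ expand-top-row D-am X ⟩
    D (clearTop X) + ∑ (λ α → X zero α * D (setCol (clearTop X) α e₀))
                                                            ≈⟨ +-cong top-cleared (expand-top-row-terms (expansion n k) D-am X) ⟩
    ∑L (map (λ e → f (suc ∘ e)) (subsets n (suc k))) + ∑L (map (f ∘ withZero) (subsets n k))
                                                            ≈⟨ +-comm _ _ ⟩
    ∑L (map (f ∘ withZero) (subsets n k)) + ∑L (map (λ e → f (suc ∘ e)) (subsets n (suc k)))
                                                            ≈⟨ ∑L-subsets-suc n k f f-resp ⟨
    ∑L (map f (subsets (suc n) (suc k)))                    ∎
    where
    open IsAlternatingMultilinear D-am
    f : (Fin (suc k) → Fin (suc n)) → Carrier
    f e = det (rows X e) * D (cols I e)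
    f-resp : f Preserves _≗_ ⟶ _≈_
    f-resp e≗e′ = *-cong (det-cong λ α j → reflexive (≡.cong (λ r → X r j) (e≗e′ α)))
                         (cong λ i α → reflexive (≡.cong (I i) (e≗e′ α)))
    top-cleared : D (clearTop X) ≈ ∑L (map (λ e → f (suc ∘ e)) (subsets n (suc k)))
    top-cleared = trans (expansion n (suc k) (padTop-alternatingMultilinear D-am) (X ∘ suc))
                        (∑L-cong (subsets n (suc k)) λ e → *-congˡ (cong λ { zero β → refl ; (suc i) β → refl }))

  ⊗ˡ-alternatingMultilinear : ∀ {n m k} {D : Matrix n k → Carrier} → IsAlternatingMultilinear D →
                              (A : Matrix n m) → IsAlternatingMultilinear (λ X → D (A ⊗ X))
  ⊗ˡ-alternatingMultilinear D-am A = record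
    { cong        = λ X≋Y → cong λ i j → ∑-cong λ l → *-congˡ (X≋Y l j)
    ; linear      = λ j a X Y Z Xj≈ X≈Y X≈Z → linear j a (A ⊗ X) (A ⊗ Y) (A ⊗ Z)
                      (λ i → ∑-linear a λ l → *-linear (A i l) (Xj≈ l))
                      (λ i β β≢j → ∑-cong λ l → *-congˡ (X≈Y l β β≢j))
                      (λ i β β≢j → ∑-cong λ l → *-congˡ (X≈Z l β β≢j))
    ; alternating = λ X a~b Xa≈Xb → alternating (A ⊗ X) a~b λ i → ∑-cong λ l → *-congˡ (Xa≈Xb l)
    }
    where open IsAlternatingMultilinear D-am

  rows-alternatingMultilinear : ∀ {n k m} {D : Matrix k m → Carrier} → IsAlternatingMultilinear D →
                                (d : Fin k → Fin n) → IsAlternatingMultilinear (λ X → D (rows X d))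
  rows-alternatingMultilinear D-am d = record
    { cong        = λ X≋Y → cong λ α j → X≋Y (d α) j
    ; linear      = λ j a X Y Z Xj≈ X≈Y X≈Z → linear j a (rows X d) (rows Y d) (rows Z d) (Xj≈ ∘ d) (X≈Y ∘ d) (X≈Z ∘ d)
    ; alternating = λ X a~b Xa≈Xb → alternating (rows X d) a~b (Xa≈Xb ∘ d)
    }
    where open IsAlternatingMultilinear D-am

  ∑L-alternatingMultilinear : ∀ {a} {A : Set a} {n k} (xs : List A) (w : A → Carrier) {D : A → Matrix n k → Carrier} →
                              (∀ x → IsAlternatingMultilinear (D x)) →
                              IsAlternatingMultilinear (λ X → ∑L (map (λ x → w x * D x X) xs))
  ∑L-alternatingMultilinear xs w D-am = record
    { cong        = λ X≋Y → ∑L-cong xs λ x → *-congˡ (cong (D-am x) X≋Y)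
    ; linear      = λ j a X Y Z Xj≈ X≈Y X≈Z → ∑L-linear xs a λ x → *-linear (w x) (linear (D-am x) j a X Y Z Xj≈ X≈Y X≈Z)
    ; alternating = λ X a~b Xa≈Xb → ∑L-zero xs λ x → trans (*-congˡ (alternating (D-am x) X a~b Xa≈Xb)) (zeroʳ _)
    }
    where open IsAlternatingMultilinear

  cullis-alternatingMultilinear : ∀ {n k} → IsAlternatingMultilinear (cullis {n} {k})
  cullis-alternatingMultilinear {n} {k} =
    ∑L-alternatingMultilinear (subsets n k) sgn λ d → rows-alternatingMultilinear det-alternatingMultilinear d

  ∑L-subsets-square : ∀ k (f : (Fin k → Fin k) → Carrier) → f Preserves _≗_ ⟶ _≈_ →
                      ∑L (map f (subsets k k)) ≈ f (λ i → i)
  ∑L-subsets-square zero    f f-resp = trans (+-identityʳ _) (f-resp λ ())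
  ∑L-subsets-square (suc k) f f-resp = begin
    ∑L (map f (subsets (suc k) (suc k)))          ≈⟨ ∑L-subsets-suc k k f f-resp ⟩
    ∑L (map (f ∘ withZero) (subsets k k)) + ∑L (map (λ d → f (suc ∘ d)) (subsets k (suc k)))
      ≈⟨ +-cong (∑L-subsets-square k (f ∘ withZero) (f-resp ∘ withZero-cong))
                (reflexive (≡.cong (λ ds → ∑L (map (λ d → f (suc ∘ d)) ds)) (subsets-empty k (suc k) ≤-refl))) ⟩
    f (withZero (λ i → i)) + 0#                   ≈⟨ +-identityʳ _ ⟩
    f (withZero (λ i → i))                        ≈⟨ f-resp (λ { zero → ≡.refl ; (suc i) → ≡.refl }) ⟩
    f (λ i → i)                                   ∎

  -- Expand B ↦ D (M ⊗ B) by `expansion`: the only k-subset of k is everything.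
  ⊗-det : ∀ {n k} {D : Matrix n k → Carrier} → IsAlternatingMultilinear D →
          ∀ (M : Matrix n k) B → D (M ⊗ B) ≈ D M * det B
  ⊗-det {n} {k} {D} D-am M B = begin
    D (M ⊗ B)                                                        ≈⟨ expansion k k (⊗ˡ-alternatingMultilinear D-am M) B ⟩
    ∑L (map (λ e → det (rows B e) * D (M ⊗ cols I e)) (subsets k k)) ≈⟨ ∑L-subsets-square k _ resp ⟩
    det B * D (M ⊗ I)                                                ≈⟨ *-comm _ _ ⟩
    D (M ⊗ I) * det B                                                ≈⟨ *-congʳ (cong (⊗-identityʳ M)) ⟩
    D M * det B                                                      ∎
    where
    open IsAlternatingMultilinear D-am
    resp : (λ e → det (rows B e) * D (M ⊗ cols I e)) Preserves _≗_ ⟶ _≈_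
    resp e≗e′ = *-cong (det-cong λ α j → reflexive (≡.cong (λ r → B r j) (e≗e′ α)))
                       (cong λ i α → ∑-cong λ l → reflexive (≡.cong (λ r → M i l * I l r) (e≗e′ α)))

  identityMinor : ∀ {n k} → (Fin k → Fin n) → (Fin k → Fin n) → Carrier
  identityMinor e d = det (rows (cols I d) e)

  identityMinor-cong : ∀ {n k} {e e′ d d′ : Fin k → Fin n} → e ≗ e′ → d ≗ d′ → identityMinor e d ≈ identityMinor e′ d′
  identityMinor-cong e≗e′ d≗d′ = det-cong λ α β → reflexive (≡.cong₂ I (e≗e′ α) (d≗d′ β))

  identityMinor-withZero : ∀ {n k} (e d : Fin k → Fin n) → identityMinor (withZero e) (withZero d) ≈ identityMinor e d
  identityMinor-withZero {k = k} e d = begin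
    neg1^ 0 * (1# * identityMinor e d) + ∑ {k} (λ j → expansionTerm M (suc j))
      ≈⟨ +-cong (trans (*-identityˡ _) (*-identityˡ _)) (∑-zero λ j → trans (*-congˡ (zeroˡ (det (minor M (suc j))))) (zeroʳ _)) ⟩
    identityMinor e d + 0#                  ≈⟨ +-identityʳ _ ⟩
    identityMinor e d                       ∎
    where
    M = rows (cols I (withZero d)) (withZero e)

  identityMinor-suc-withZero : ∀ {n k} (e : Fin (suc k) → Fin n) (d : Fin k → Fin n) →
                               identityMinor (suc ∘ e) (withZero d) ≈ 0#
  identityMinor-suc-withZero e d =
    IsAlternatingMultilinear.zeroColumn det-alternatingMultilinear (rows (cols I (withZero d)) (suc ∘ e)) zero λ _ → refl

  identityMinor-withZero-suc : ∀ {n k} (e : Fin k → Fin n) (d : Fin (suc k) → Fin n) →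
                               identityMinor (withZero e) (suc ∘ d) ≈ 0#
  identityMinor-withZero-suc e d = ∑-zero λ j → trans (*-congˡ {neg1^ (toℕ j)} (zeroˡ (det (minor M j)))) (zeroʳ _)
    where
    M = rows (cols I (suc ∘ d)) (withZero e)

  module _ {n k} (f : (Fin k → Fin n) → Carrier) (f-resp : f Preserves _≗_ ⟶ _≈_) where

    identityMinor-term-resp : ∀ d → (λ e → f e * identityMinor e d) Preserves _≗_ ⟶ _≈_
    identityMinor-term-resp d e≗e′ = *-cong (f-resp e≗e′) (identityMinor-cong {d = d} e≗e′ λ _ → ≡.refl)

    ∑L-identityMinor-cong : ∀ es {d d′} → d ≗ d′ →
                            ∑L (map (λ e → f e * identityMinor e d) es) ≈ ∑L (map (λ e → f e * identityMinor e d′) es)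
    ∑L-identityMinor-cong es d≗d′ = ∑L-cong es λ e → *-congˡ (identityMinor-cong {e = e} (λ _ → ≡.refl) d≗d′)

  -- On k-subsets, e ↦ det I[e|d) is the indicator function of d.
  ∑L-subsets-identityMinor : ∀ n k {d : Fin k → Fin n} → StrictlyIncreasing d →
                             (f : (Fin k → Fin n) → Carrier) → f Preserves _≗_ ⟶ _≈_ →
                             ∑L (map (λ e → f e * identityMinor e d) (subsets n k)) ≈ f d
  ∑L-subsets-identityMinor n zero _ f f-resp = trans (+-identityʳ _) (trans (*-identityʳ _) (f-resp λ ()))
  ∑L-subsets-identityMinor zero (suc k) {d} _ _ _ with () ← d zero
  ∑L-subsets-identityMinor (suc n) (suc k) {d} d↑ f f-resp with increasing-split d↑
  ... | inj₁ (d′ , d′↑ , d′≗d) = begin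
    ∑L (map (λ e → f e * identityMinor e d) (subsets (suc n) (suc k)))
      ≈⟨ ∑L-identityMinor-cong f f-resp (subsets (suc n) (suc k)) (≡.sym ∘ d′≗d) ⟩
    ∑L (map (λ e → f e * identityMinor e (withZero d′)) (subsets (suc n) (suc k)))
      ≈⟨ ∑L-subsets-suc n k _ (identityMinor-term-resp f f-resp (withZero d′)) ⟩
    ∑L (map (λ e → f (withZero e) * identityMinor (withZero e) (withZero d′)) (subsets n k))
      + ∑L (map (λ e → f (suc ∘ e) * identityMinor (suc ∘ e) (withZero d′)) (subsets n (suc k)))
      ≈⟨ +-cong (∑L-cong (subsets n k) λ e → *-congˡ (identityMinor-withZero e d′))
                (∑L-zero (subsets n (suc k)) λ e → trans (*-congˡ (identityMinor-suc-withZero e d′)) (zeroʳ _)) ⟩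
    ∑L (map (λ e → f (withZero e) * identityMinor e d′) (subsets n k)) + 0#
      ≈⟨ +-identityʳ _ ⟩
    ∑L (map (λ e → f (withZero e) * identityMinor e d′) (subsets n k))
      ≈⟨ ∑L-subsets-identityMinor n k d′↑ (f ∘ withZero) (f-resp ∘ withZero-cong) ⟩
    f (withZero d′)                                                      ≈⟨ f-resp d′≗d ⟩
    f d                                                                  ∎
  ... | inj₂ (d′ , d′↑ , d′≗d) = begin
    ∑L (map (λ e → f e * identityMinor e d) (subsets (suc n) (suc k)))
      ≈⟨ ∑L-identityMinor-cong f f-resp (subsets (suc n) (suc k)) (≡.sym ∘ d′≗d) ⟩
    ∑L (map (λ e → f e * identityMinor e (suc ∘ d′)) (subsets (suc n) (suc k)))
      ≈⟨ ∑L-subsets-suc n k _ (identityMinor-term-resp f f-resp (suc ∘ d′)) ⟩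
    ∑L (map (λ e → f (withZero e) * identityMinor (withZero e) (suc ∘ d′)) (subsets n k))
      + ∑L (map (λ e → f (suc ∘ e) * identityMinor e d′) (subsets n (suc k)))
      ≈⟨ +-congʳ (∑L-zero (subsets n k) λ e → trans (*-congˡ (identityMinor-withZero-suc e d′)) (zeroʳ _)) ⟩
    0# + ∑L (map (λ e → f (suc ∘ e) * identityMinor e d′) (subsets n (suc k)))
      ≈⟨ +-identityˡ _ ⟩
    ∑L (map (λ e → f (suc ∘ e) * identityMinor e d′) (subsets n (suc k)))
      ≈⟨ ∑L-subsets-identityMinor n (suc k) d′↑ (λ e → f (suc ∘ e)) (λ e≗e′ → f-resp (≡.cong suc ∘ e≗e′)) ⟩
    f (suc ∘ d′)                                                         ≈⟨ f-resp d′≗d ⟩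
    f d                                                                  ∎

  sgn-cong : ∀ {n k} → sgn {n} {k} Preserves _≗_ ⟶ _≈_
  sgn-cong d≗d′ = reflexive (≡.cong neg1^ (sumℕ-cong λ α → ≡.cong (λ x → toℕ x ℕ.∸ toℕ α) (d≗d′ α)))

  cullis-cols-I : ∀ {n k} {d : Fin k → Fin n} → StrictlyIncreasing d → cullis (cols I d) ≈ sgn d
  cullis-cols-I {n} {k} d↑ = ∑L-subsets-identityMinor n k d↑ sgn sgn-cong

  characterisation : ∀ {n k} (A : Matrix n n) (B : Matrix k k) →
                     (∀ X → cullis (A ⊗ X ⊗ B) ≈ cullis X) ⇔
                     (∀ d → StrictlyIncreasing d → cullis (cols A d) * det B ≈ sgn d)
  characterisation {n} {k} A B = mk⇔ preserved⇒ ⇒preserved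
    where
    open IsAlternatingMultilinear (cullis-alternatingMultilinear {n} {k}) using (cong)
    A⊗cols-I : ∀ d → A ⊗ cols I d ≋ cols A d
    A⊗cols-I d i α = ⊗-identityʳ A i (d α)
    preserved⇒ : (∀ X → cullis (A ⊗ X ⊗ B) ≈ cullis X) → ∀ d → StrictlyIncreasing d → cullis (cols A d) * det B ≈ sgn d
    preserved⇒ preserved d d↑ = begin
      cullis (cols A d) * det B           ≈⟨ *-congʳ (cong (A⊗cols-I d)) ⟨
      cullis (A ⊗ cols I d) * det B       ≈⟨ ⊗-det cullis-alternatingMultilinear (A ⊗ cols I d) B ⟨
      cullis (A ⊗ cols I d ⊗ B)           ≈⟨ preserved (cols I d) ⟩
      cullis (cols I d)                   ≈⟨ cullis-cols-I d↑ ⟩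
      sgn d                               ∎
    ⇒preserved : (∀ d → StrictlyIncreasing d → cullis (cols A d) * det B ≈ sgn d) → ∀ X → cullis (A ⊗ X ⊗ B) ≈ cullis X
    ⇒preserved columns X = begin
      cullis (A ⊗ X ⊗ B)                                                      ≈⟨ ⊗-det cullis-alternatingMultilinear (A ⊗ X) B ⟩
      cullis (A ⊗ X) * det B
        ≈⟨ *-congʳ (expansion n k (⊗ˡ-alternatingMultilinear cullis-alternatingMultilinear A) X) ⟩
      ∑L (map (λ e → det (rows X e) * cullis (A ⊗ cols I e)) (subsets n k)) * det B
        ≈⟨ *-distribʳ-∑L (subsets n k) (det B) _ ⟩
      ∑L (map (λ e → det (rows X e) * cullis (A ⊗ cols I e) * det B) (subsets n k))
        ≈⟨ ∑L-cong-All (subsets-increasing n k) term ⟩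
      cullis X                                                                ∎
      where
      term : ∀ e → StrictlyIncreasing e → det (rows X e) * cullis (A ⊗ cols I e) * det B ≈ sgn e * det (rows X e)
      term e e↑ = begin
        det (rows X e) * cullis (A ⊗ cols I e) * det B    ≈⟨ *-assoc _ _ _ ⟩
        det (rows X e) * (cullis (A ⊗ cols I e) * det B)  ≈⟨ *-congˡ (trans (*-congʳ (cong (A⊗cols-I e))) (columns e e↑)) ⟩
        det (rows X e) * sgn e                            ≈⟨ *-comm _ _ ⟩
        sgn e * det (rows X e)                            ∎

open Defs using (Matrix; cullis; det; sgn; cols; _⊗_)

lemma8 : ∀ {c ℓ} (F : Field c ℓ) (n k : ℕ) → 1 ≤ k → k ≤ n →
         (A : Matrix F n n) (B : Matrix F k k) →
         (∀ (X : Matrix F n k) →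
            Field._≈_ F (cullis F (_⊗_ F (_⊗_ F A X) B)) (cullis F X))
         ⇔
         (∀ (d : Fin k → Fin n) → StrictlyIncreasing d →
            Field._≈_ F (Field._*_ F (cullis F (cols F A d)) (det F B)) (sgn F d))
lemma8 F n k _ _ A B = CullisDeterminant.characterisation F A B
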